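{- For every signed permutation $\sigma$, $\varphi_2(\sigma\overline{\star}_{ -1}1^-)=\varphi_2(1^-\overline{\star}_{ -1}\sigma)=0$, where $1^-\in\mathfrak{B}_1$ is the signed permutation sending $1$ to $-1$.
   Context: $\mathfrak{B}_n$ is the set of permutations $\pi$ of $\{ -n,\dots,n\}$ with $\pi(-i)=-\pi(i)$, written as words $\pi_1\cdots\pi_n$, $\mathfrak{B}_0=\{\imath\}$; $\mathfrak{S}_n$ those with all entries positive. $\mathrm{st}$ of a word $a_1\cdots a_n$ over $\mathbb{Z}\setminus\{0\}$ is the unique $b_1\cdots b_n\in\mathfrak{B}_n$ with $\mathrm{sign}(b_i)=\mathrm{sign}(a_i)$ and $|b_i|<|b_j|$ whenever $|a_i|<|a_j|$ or ($|a_i|=|a_j|$, $i<j$), extended linearly. On words over $\mathbb{Z}\setminus\{0\}$, $\star_{ -1}$ is the bilinear product with the empty word as identity and $au\star_{ -1}bv=a(u\star_{ -1}bv)+b(au\star_{ -1}v)-(a\bullet b)(u\star_{ -1}v)$, where $a\bullet b=a$ if $a,b<0$ and $0$ otherwise. For $\sigma\in\mathfrak{B}_m,\tau\in\mathfrak{B}_n$, $\sigma\overline{\star}_{ -1}\tau=\mathrm{st}(\sigma\star_{ -1}\tau[m])$, where $\tau[m]$ replaces positive letters $i$ by $i+m$ and negative letters $-i$ by $-(i+m)$. The linear map $\varphi_2:\bigoplus_n\mathbf{k}\mathfrak{B}_n\to\bigoplus_n\mathbf{k}\mathfrak{S}_n$ is defined on $\pi\in\mathfrak{B}_n$ by $\varphi_2(\pi)=(-1)^j\mathrm{st}(\bar\pi)$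 if there are $i\ge0$, $j\in\{0,1\}$ with $i+j<n$ such that $\pi_k<0$ for $k\le i$ and for $k>n-j$, and $\pi_k>0$ for $i<k\le n-j$ ($\bar\pi$ being the subword of positive entries), and $\varphi_2(\pi)=\delta_{\pi,\imath}$ otherwise. -}

module Defs where

open import Data.Bool using (Bool; true; false; _∧_; _∨_; if_then_else_; not)
open import Data.Nat as ℕ using (ℕ; zero; suc; _≤ᵇ_; _<ᵇ_; _≡ᵇ_)
open import Data.Integer as ℤ using (ℤ; +_; -[1+_]; ∣_∣)
open import Data.List using (List; []; _∷_; map; length; upTo; zip; filter; applyUpTo; concatMap)
open import Data.List.Properties using (≡-dec)
open import Data.Product using (_×_; _,_; proj₁; proj₂)
open import Relation.Nullary using (does)
open import Relation.Binary.PropositionalEquality using (_≡_)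
open import Data.List.Relation.Binary.Permutation.Propositional using (_↭_)

-- Words over ℤ∖{0} are lists of integers.
Word : Set
Word = List ℤ

LinComb : Set
LinComb = List (ℤ × Word)

coeff : Word → LinComb → ℤ
coeff w [] = ℤ.0ℤ
coeff w ((c , v) ∷ L) =
  (if does (≡-dec ℤ._≟_ w v) then c else ℤ.0ℤ) ℤ.+ coeff w L

IsZero : LinComb → Set
IsZero L = ∀ (w : Word) → coeff w L ≡ ℤ.0ℤ

IsSignedPerm : Word → Set
IsSignedPerm π = map ∣_∣ π ↭ applyUpTo suc (length π)

isNeg : ℤ → Bool
isNeg -[1+ _ ] = true
isNeg (+ _)    = false

isPos : ℤ → Bool
isPos (+ suc _) = true
isPos _         = false

prefix : ℤ → LinComb → LinComb
prefix a = map (λ p → (proj₁ p , a ∷ proj₂ p))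

negL : LinComb → LinComb
negL = map (λ p → (ℤ.- proj₁ p , proj₂ p))

_++L_ : LinComb → LinComb → LinComb
[] ++L M = M
(x ∷ L) ++L M = x ∷ (L ++L M)

infixl 7 _⋆_
_⋆_ : Word → Word → LinComb
[] ⋆ v = (ℤ.1ℤ , v) ∷ []
(a ∷ u) ⋆ [] = (ℤ.1ℤ , a ∷ u) ∷ []
(a ∷ u) ⋆ (b ∷ v) =
  prefix a (u ⋆ (b ∷ v)) ++L
  (prefix b ((a ∷ u) ⋆ v) ++L
  (if isNeg a ∧ isNeg b then negL (prefix a (u ⋆ v)) else []))

shiftLetter : ℕ → ℤ → ℤ
shiftLetter m (+ k)      = + (k ℕ.+ m)
shiftLetter m -[1+ k ]   = -[1+ (k ℕ.+ m) ]

shift : ℕ → Word → Word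
shift m = map (shiftLetter m)

indexed : Word → List (ℕ × ℤ)
indexed w = zip (upTo (length w)) w

before : ℕ × ℤ → ℕ × ℤ → Bool
before (j , aj) (i , ai) =
  (∣ aj ∣ <ᵇ ∣ ai ∣) ∨ ((∣ aj ∣ ≡ᵇ ∣ ai ∣) ∧ (j <ᵇ i))

countTrue : List Bool → ℕ
countTrue [] = 0
countTrue (true ∷ bs) = suc (countTrue bs)
countTrue (false ∷ bs) = countTrue bs

withSign : ℤ → ℕ → ℤ
withSign a r = if isNeg a then ℤ.- (+ r) else + r

st : Word → Word
st w = map (λ p → withSign (proj₂ p)
                    (suc (countTrue (map (λ q → before q p) (indexed w)))))
           (indexed w)

stL : LinComb → LinComb
stL = map (λ p → (proj₁ p , st (proj₂ p)))

_⋆̄_ : Word → Word → LinComb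
σ ⋆̄ τ = stL (σ ⋆ shift (length σ) τ)

one⁻ : Word
one⁻ = -[1+ 0 ] ∷ []

allB : {A : Set} → (A → Bool) → List A → Bool
allB f [] = true
allB f (x ∷ xs) = f x ∧ allB f xs

-- the shape condition in the definition of φ₂ for given i, j (1-indexed positions k)
shapeOK : Word → ℕ → ℕ → Bool
shapeOK π i j =
  ((i ℕ.+ j) <ᵇ n) ∧
  allB (λ p → let k = suc (proj₁ p) ; x = proj₂ p in
         (if k ≤ᵇ i then isNeg x else true) ∧
         (if (n ℕ.∸ j) <ᵇ k then isNeg x else true) ∧
         (if (i <ᵇ k) ∧ (k ≤ᵇ (n ℕ.∸ j)) then isPos x else true))
      (indexed π)
  where n = length π

positives : Word → Word
positives = filter (λ x → isPos' x)
  where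
  open import Relation.Unary using (Decidable)
  open import Relation.Nullary.Decidable using (yes; no)
  open import Data.Bool.Properties using (T?)
  open import Data.Bool using (T)
  isPos' : Decidable (λ x → T (isPos x))
  isPos' x = T? (isPos x)

candidates : ℕ → List (ℕ × ℕ)
candidates n = concatMap (λ i → (i , 0) ∷ (i , 1) ∷ []) (upTo (suc n))

-- first matching (i , j), if any (it is unique when it exists)
findShape : Word → List (ℕ × ℕ) → LinComb
findShape π [] = if does (≡-dec ℤ._≟_ π []) then (ℤ.1ℤ , []) ∷ [] else []
findShape π ((i , j) ∷ cs) =
  if shapeOK π i j
  then ((if j ≡ᵇ 0 then ℤ.1ℤ else ℤ.-1ℤ) , st (positives π)) ∷ []
  else findShape π cs

φ₂ : Word → LinComb
φ₂ π = findShape π (candidates (length π))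

φ₂L : LinComb → LinComb
φ₂L [] = []
φ₂L ((c , π) ∷ L) = map (λ p → (c ℤ.* proj₁ p , proj₂ p)) (φ₂ π) ++L φ₂L L

-- Each term of σ ⋆₋₁ 1⁻ (and of 1⁻ ⋆₋₁ σ) is σ with one extra negative letter, inserted
-- somewhere or merged into a negative letter of σ, so all terms have the same positive subword
-- as σ.  Standardization keeps signs and the relative order of letters, so st of the positive
-- subword of a standardized word is st σ̄; hence φ₂ sends every term to ±st σ̄ or to 0, with a
-- scalar that depends only on the sign pattern of the term.  Reading sign patterns with a
-- four-state automaton, the sum of these scalars becomes a function of the signs of σ alone,
-- and an induction over that sign sequence shows that it vanishes.

module Submission where

open import Defs
open import Data.Bool using (Bool; true; false; _∧_; _∨_; not; if_then_else_; T)
open import Data.Bool.Properties using (T-≡; T-not-≡; T-∨; T-∧; ∧-zeroʳ; ∧-identityʳ; ∨-identityʳ)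
open import Data.Integer as ℤ using (ℤ; +_; -[1+_]; ∣_∣; _+_; _-_; _*_; -_)
import Data.Integer.Properties as ℤ
open import Data.Integer.Tactic.RingSolver using (solve-∀)
open import Algebra.Properties.CommutativeSemigroup ℤ.+-commutativeSemigroup using (x∙yz≈y∙xz)
open import Data.List using (List; []; _∷_; map; length; zip; applyUpTo; concatMap)
open import Data.List.Membership.Propositional using (_∈_)
open import Data.List.Membership.Propositional.Properties using (∈-map⁺; ∈-applyUpTo⁻)
open import Data.List.Relation.Binary.Permutation.Propositional.Properties using (∈-resp-↭)
open import Data.List.Properties using (≡-dec)
open import Data.Empty using (⊥-elim)
open import Data.List.Relation.Binary.Pointwise as Pointwise using (Pointwise; []; _∷_; Pointwise-≡⇒≡)
open import Data.List.Relation.Unary.All as All using (All; []; _∷_)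
open import Data.List.Relation.Unary.AllPairs using (AllPairs; []; _∷_)
open import Data.List.Relation.Unary.Any using (here; there)
open import Data.Nat as ℕ using (ℕ; zero; suc; _<_; _≤_; _∸_; _≤ᵇ_; _<ᵇ_; _≡ᵇ_; z≤n; s≤s)
open import Data.Nat.Properties
  using (+-suc; +-∸-assoc; ≰⇒>; m≤n+m; <ᵇ⇒<; <⇒<ᵇ; ≡ᵇ⇒≡; ≡⇒≡ᵇ; ≤⇒≤ᵇ; <⇒≤; ≤-trans; n≤1+n; m<n⇒m<1+n
        ; <-isStrictPartialOrder)
open import Data.Product using (_×_; _,_; proj₁; proj₂; map₁)
open import Data.Product.Relation.Binary.Lex.Strict using (×-Lex; ×-isStrictPartialOrder)
open import Data.Sum using (inj₁; inj₂)
open import Function using (_∘_; id)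
open import Function.Bundles using (Equivalence)
open import Relation.Binary.Core using (_Preserves_⟶_)
open import Relation.Binary.PropositionalEquality
open import Relation.Binary.Structures using (IsStrictPartialOrder)
open import Relation.Nullary using (does; yes; no)

-- Standardization

T⇒≡true : ∀ {b} → T b → b ≡ true
T⇒≡true = Equivalence.to T-≡

≡true⇒T : ∀ {b} → b ≡ true → T b
≡true⇒T = Equivalence.from T-≡

suc-≤ᵇ-suc : ∀ m n → (suc m ≤ᵇ suc n) ≡ (m ≤ᵇ n)
suc-≤ᵇ-suc zero    n = refl
suc-≤ᵇ-suc (suc m) n = refl

<ᵇ-irrefl : ∀ n → (n <ᵇ n) ≡ false
<ᵇ-irrefl zero    = refl
<ᵇ-irrefl (suc n) = <ᵇ-irrefl n

<ᵇ∨≡ᵇ : ∀ m n → ((m <ᵇ n) ∨ (m ≡ᵇ n)) ≡ (m ≤ᵇ n)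
<ᵇ∨≡ᵇ zero    zero    = refl
<ᵇ∨≡ᵇ zero    (suc n) = refl
<ᵇ∨≡ᵇ (suc m) zero    = refl
<ᵇ∨≡ᵇ (suc m) (suc n) = trans (<ᵇ∨≡ᵇ m n) (sym (suc-≤ᵇ-suc m n))

<ᵇ≡not-≤ᵇ : ∀ m n → (n <ᵇ m) ≡ not (m ≤ᵇ n)
<ᵇ≡not-≤ᵇ zero    zero    = refl
<ᵇ≡not-≤ᵇ zero    (suc n) = refl
<ᵇ≡not-≤ᵇ (suc m) zero    = refl
<ᵇ≡not-≤ᵇ (suc m) (suc n) = trans (<ᵇ≡not-≤ᵇ m n) (cong not (sym (suc-≤ᵇ-suc m n)))

>⇒≤ᵇ-false : ∀ {m n} → n < m → (m ≤ᵇ n) ≡ false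
>⇒≤ᵇ-false {m} {n} n<m = Equivalence.to T-not-≡ (subst T (<ᵇ≡not-≤ᵇ m n) (<⇒<ᵇ n<m))

before-irrefl : ∀ p → before p p ≡ false
before-irrefl (i , x) rewrite <ᵇ-irrefl ∣ x ∣ | <ᵇ-irrefl i = ∧-zeroʳ (∣ x ∣ ≡ᵇ ∣ x ∣)

before-forward : ∀ {i k} x y → i < k → before (i , x) (k , y) ≡ (∣ x ∣ ≤ᵇ ∣ y ∣)
before-forward x y i<k rewrite T⇒≡true (<⇒<ᵇ i<k) | ∧-identityʳ (∣ x ∣ ≡ᵇ ∣ y ∣) =
  <ᵇ∨≡ᵇ ∣ x ∣ ∣ y ∣

before-backward : ∀ {i k} x y → i < k → before (k , y) (i , x) ≡ not (∣ x ∣ ≤ᵇ ∣ y ∣)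
before-backward {i} {k} x y i<k
  rewrite >⇒≤ᵇ-false {suc k} {i} (m<n⇒m<1+n i<k) | ∧-zeroʳ (∣ y ∣ ≡ᵇ ∣ x ∣) =
  trans (∨-identityʳ (∣ y ∣ <ᵇ ∣ x ∣)) (<ᵇ≡not-≤ᵇ ∣ x ∣ ∣ y ∣)

_<ₗₑₓ_ : ℕ × ℕ → ℕ × ℕ → Set
_<ₗₑₓ_ = ×-Lex _≡_ _<_ _<_

key : ℕ × ℤ → ℕ × ℕ
key (i , x) = ∣ x ∣ , i

before⇒<ₗₑₓ : ∀ p q → before p q ≡ true → key p <ₗₑₓ key q
before⇒<ₗₑₓ (j , x) (i , y) h with Equivalence.to T-∨ (≡true⇒T h)
... | inj₁ lt = inj₁ (<ᵇ⇒< _ _ lt)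
... | inj₂ eq∧lt with Equivalence.to T-∧ eq∧lt
...   | eq , lt = inj₂ (≡ᵇ⇒≡ _ _ eq , <ᵇ⇒< _ _ lt)

<ₗₑₓ⇒before : ∀ p q → key p <ₗₑₓ key q → before p q ≡ true
<ₗₑₓ⇒before p q (inj₁ lt) = T⇒≡true (Equivalence.from T-∨ (inj₁ (<⇒<ᵇ lt)))
<ₗₑₓ⇒before p q (inj₂ (eq , lt)) =
  T⇒≡true (Equivalence.from T-∨ (inj₂ (Equivalence.from T-∧ (≡⇒≡ᵇ _ _ eq , <⇒<ᵇ lt))))

before-trans : ∀ p q r → before p q ≡ true → before q r ≡ true → before p r ≡ true
before-trans p q r p<q q<r = <ₗₑₓ⇒before p r
  (IsStrictPartialOrder.trans (×-isStrictPartialOrder <-isStrictPartialOrder <-isStrictPartialOrder)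
    (before⇒<ₗₑₓ p q p<q) (before⇒<ₗₑₓ q r q<r))

module _ {A : Set} {f g : A → Bool} (f⇒g : ∀ {s} → f s ≡ true → g s ≡ true) where

  countTrue-mono : ∀ L → countTrue (map f L) ≤ countTrue (map g L)
  countTrue-mono [] = z≤n
  countTrue-mono (x ∷ L) with f x in fx | g x in gx
  ... | true  | true  = s≤s (countTrue-mono L)
  ... | true  | false with () ← trans (sym gx) (f⇒g fx)
  ... | false | true  = ≤-trans (countTrue-mono L) (n≤1+n _)
  ... | false | false = countTrue-mono L

  countTrue-strictMono : ∀ {L p} → p ∈ L → f p ≡ false → g p ≡ true →
                         countTrue (map f L) < countTrue (map g L)
  countTrue-strictMono {x ∷ L} (here refl) fx gx rewrite fx | gx = s≤s (countTrue-mono L)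
  countTrue-strictMono {x ∷ L} (there p∈L) fp gp with f x in fx | g x in gx
  ... | true  | true  = s≤s (countTrue-strictMono p∈L fp gp)
  ... | true  | false with () ← trans (sym gx) (f⇒g fx)
  ... | false | true  = ≤-trans (countTrue-strictMono p∈L fp gp) (n≤1+n _)
  ... | false | false = countTrue-strictMono p∈L fp gp

rank : List (ℕ × ℤ) → ℕ × ℤ → ℕ
rank J p = countTrue (map (λ q → before q p) J)

rank-strictMono : ∀ {J p q} → p ∈ J → before p q ≡ true → rank J p < rank J q
rank-strictMono {p = p} {q} p∈J p<q =
  countTrue-strictMono {f = λ s → before s p} {g = λ s → before s q}
    (λ {s} s<p → before-trans s p q s<p p<q) p∈J (before-irrefl p) p<q

rank-≤ᵇ : ∀ {J i k x y} → (i , x) ∈ J → (k , y) ∈ J → i < k →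
          (rank J (i , x) ≤ᵇ rank J (k , y)) ≡ (∣ x ∣ ≤ᵇ ∣ y ∣)
rank-≤ᵇ {J} {i} {k} {x} {y} p∈J q∈J i<k with ∣ x ∣ ≤ᵇ ∣ y ∣ in x≤y
... | true  =
  T⇒≡true (≤⇒≤ᵇ (<⇒≤ (rank-strictMono {J} {i , x} {k , y} p∈J (trans (before-forward x y i<k) x≤y))))
... | false =
  >⇒≤ᵇ-false (rank-strictMono {J} {k , y} {i , x} q∈J (trans (before-backward x y i<k) (cong not x≤y)))

rank-cong : ∀ {J J'} p p' → Pointwise (λ q q' → before q p ≡ before q' p') J J' →
            rank J p ≡ rank J' p'
rank-cong p p' agree = cong countTrue (Pointwise-≡⇒≡ (Pointwise.map⁺ _ _ agree))

standardizeAt : List (ℕ × ℤ) → List (ℕ × ℤ) → Word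
standardizeAt J = map (λ p → withSign (proj₂ p) (suc (rank J p)))

indexedFrom : (ℕ → ℕ) → Word → List (ℕ × ℤ)
indexedFrom f w = zip (applyUpTo f (length w)) w

map-proj₂-indexedFrom : ∀ f w → map proj₂ (indexedFrom f w) ≡ w
map-proj₂-indexedFrom f []      = refl
map-proj₂-indexedFrom f (x ∷ w) = cong (x ∷_) (map-proj₂-indexedFrom (f ∘ suc) w)

indexedFrom-above : ∀ {c} g w → (∀ k → c < g k) → All (λ q → c < proj₁ q) (indexedFrom g w)
indexedFrom-above g []      c<g = []
indexedFrom-above g (x ∷ w) c<g = c<g 0 ∷ indexedFrom-above (g ∘ suc) w (c<g ∘ suc)

indexedFrom-increasing : ∀ {f} → f Preserves _<_ ⟶ _<_ → ∀ w →
                         AllPairs (λ p q → proj₁ p < proj₁ q) (indexedFrom f w)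
indexedFrom-increasing         f-mono []      = []
indexedFrom-increasing {f = f} f-mono (x ∷ w) =
  indexedFrom-above (f ∘ suc) w (λ _ → f-mono (s≤s z≤n)) ∷ indexedFrom-increasing (f-mono ∘ s≤s) w

-- The data that st depends on: signs, and how each letter compares with every later one.
data Similar : Word → Word → Set where
  []   : Similar [] []
  cons : ∀ {a b u v} → isNeg a ≡ isNeg b →
         Pointwise (λ x y → (∣ a ∣ ≤ᵇ ∣ x ∣) ≡ (∣ b ∣ ≤ᵇ ∣ y ∣)) u v →
         Similar u v → Similar (a ∷ u) (b ∷ v)

RankAgree : (J J' K K' : List (ℕ × ℤ)) → Set
RankAgree J J' = Pointwise λ p p' →
  isNeg (proj₂ p) ≡ isNeg (proj₂ p') × Pointwise (λ q q' → before q p ≡ before q' p') J J'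

standardizeAt-cong : ∀ {J J' K K'} → RankAgree J J' K K' → standardizeAt J K ≡ standardizeAt J' K'
standardizeAt-cong agree =
  Pointwise-≡⇒≡ (Pointwise.map⁺ _ _ (Pointwise.map (λ {p} {p'} → same-letter p p') agree))
  where
  same-letter : ∀ {J J'} p p' →
    isNeg (proj₂ p) ≡ isNeg (proj₂ p') × Pointwise (λ q q' → before q p ≡ before q' p') J J' →
    withSign (proj₂ p) (suc (rank J p)) ≡ withSign (proj₂ p') (suc (rank J' p'))
  same-letter p p' (sign , ranks) =
    cong₂ (λ neg r → if neg then - (+ r) else + r) sign (cong suc (rank-cong p p' ranks))

RankAgree-∷ : ∀ {x x' J J' K K'} → Pointwise (λ p p' → before x p ≡ before x' p') K K' →
              RankAgree J J' K K' → RankAgree (x ∷ J) (x' ∷ J') K K'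
RankAgree-∷ []       []                 = []
RankAgree-∷ (e ∷ es) ((sign , ranks) ∷ agree) = (sign , e ∷ ranks) ∷ RankAgree-∷ es agree

comparisons-with-later : ∀ a b {c u v} g → (∀ k → c < g k) →
  Pointwise (λ x y → (∣ a ∣ ≤ᵇ ∣ x ∣) ≡ (∣ b ∣ ≤ᵇ ∣ y ∣)) u v →
  Pointwise (λ p p' → before (c , a) p ≡ before (c , b) p' × before p (c , a) ≡ before p' (c , b))
            (indexedFrom g u) (indexedFrom g v)
comparisons-with-later a b g c<g [] = []
comparisons-with-later a b {u = x ∷ u} {y ∷ v} g c<g (e ∷ es) =
  (trans (before-forward a x (c<g 0)) (trans e (sym (before-forward b y (c<g 0))))
  , trans (before-backward a x (c<g 0)) (trans (cong not e) (sym (before-backward b y (c<g 0)))))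
  ∷ comparisons-with-later a b (g ∘ suc) (c<g ∘ suc) es

Similar⇒RankAgree : ∀ {f u v} → f Preserves _<_ ⟶ _<_ → Similar u v →
  RankAgree (indexedFrom f u) (indexedFrom f v) (indexedFrom f u) (indexedFrom f v)
Similar⇒RankAgree f-mono [] = []
Similar⇒RankAgree {f} f-mono (cons {a} {b} sign cmp sim) =
  (sign , trans (before-irrefl (f 0 , a)) (sym (before-irrefl (f 0 , b))) ∷ Pointwise.map proj₂ later)
  ∷ RankAgree-∷ (Pointwise.map proj₁ later) (Similar⇒RankAgree (f-mono ∘ s≤s) sim)
  where later = comparisons-with-later a b (f ∘ suc) (λ _ → f-mono (s≤s z≤n)) cmp

st-resp-Similar : ∀ {u v} → Similar u v → st u ≡ st v
st-resp-Similar sim = standardizeAt-cong (Similar⇒RankAgree id sim)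

∣withSign∣ : ∀ a r → ∣ withSign a (suc r) ∣ ≡ suc r
∣withSign∣ (+ _)    r = refl
∣withSign∣ -[1+ _ ] r = refl

isNeg-withSign : ∀ a r → isNeg (withSign a (suc r)) ≡ isNeg a
isNeg-withSign (+ _)    r = refl
isNeg-withSign -[1+ _ ] r = refl

Similar-standardizeAt : ∀ J K → All (_∈ J) K → AllPairs (λ p q → proj₁ p < proj₁ q) K →
                        Similar (standardizeAt J K) (map proj₂ K)
Similar-standardizeAt J []            _             _            = []
Similar-standardizeAt J ((i , x) ∷ K) (p∈J ∷ K⊆J) (p<K ∷ K↑) =
  cons (isNeg-withSign x (rank J (i , x))) (comparisons K⊆J p<K) (Similar-standardizeAt J K K⊆J K↑)
  where
  comparisons : ∀ {K} → All (_∈ J) K → All (λ q → i < proj₁ q) K →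
    Pointwise (λ y z → (∣ withSign x (suc (rank J (i , x))) ∣ ≤ᵇ ∣ y ∣) ≡ (∣ x ∣ ≤ᵇ ∣ z ∣))
              (standardizeAt J K) (map proj₂ K)
  comparisons [] [] = []
  comparisons {(k , y) ∷ K} (q∈J ∷ K⊆J) (i<k ∷ i<K) = compare-ranks ∷ comparisons K⊆J i<K
    where
    open ≡-Reasoning
    compare-ranks : (∣ withSign x (suc (rank J (i , x))) ∣ ≤ᵇ ∣ withSign y (suc (rank J (k , y))) ∣)
                    ≡ (∣ x ∣ ≤ᵇ ∣ y ∣)
    compare-ranks = begin
      ∣ withSign x (suc (rank J (i , x))) ∣ ≤ᵇ ∣ withSign y (suc (rank J (k , y))) ∣
        ≡⟨ cong₂ _≤ᵇ_ (∣withSign∣ x _) (∣withSign∣ y _) ⟩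
      suc (rank J (i , x)) ≤ᵇ suc (rank J (k , y))
        ≡⟨ suc-≤ᵇ-suc (rank J (i , x)) (rank J (k , y)) ⟩
      rank J (i , x) ≤ᵇ rank J (k , y)
        ≡⟨ rank-≤ᵇ p∈J q∈J i<k ⟩
      ∣ x ∣ ≤ᵇ ∣ y ∣ ∎

Similar-st : ∀ w → Similar (st w) w
Similar-st w = subst (Similar (st w)) (map-proj₂-indexedFrom id w)
  (Similar-standardizeAt I I (All.tabulate id) (indexedFrom-increasing id w))
  where I = indexedFrom id w

Nonzero : ℤ → Set
Nonzero x = isPos x ≡ not (isNeg x)

Nonzero-standardizeAt : ∀ J K → All Nonzero (standardizeAt J K)
Nonzero-standardizeAt J []      = []
Nonzero-standardizeAt J (p ∷ K) = nonzero (proj₂ p) ∷ Nonzero-standardizeAt J K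
  where
  nonzero : ∀ a → Nonzero (withSign a (suc (rank J p)))
  nonzero (+ _)    = refl
  nonzero -[1+ _ ] = refl

positives-∷ : ∀ x u → positives (x ∷ u) ≡ (if isPos x then x ∷ positives u else positives u)
positives-∷ (+ zero)  u = refl
positives-∷ (+ suc _) u = refl
positives-∷ -[1+ _ ]  u = refl

Similar⇒samePositivity : ∀ {u v} → Similar u v → All Nonzero u → All Nonzero v →
                         Pointwise (λ x y → isPos x ≡ isPos y) u v
Similar⇒samePositivity []                 []         []         = []
Similar⇒samePositivity (cons sign _ sim) (a≠0 ∷ u≠0) (b≠0 ∷ v≠0) =
  trans a≠0 (trans (cong not sign) (sym b≠0)) ∷ Similar⇒samePositivity sim u≠0 v≠0

Pointwise-positives : ∀ {R : ℤ → ℤ → Set} {u v} → Pointwise (λ x y → isPos x ≡ isPos y) u v →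
                      Pointwise R u v → Pointwise R (positives u) (positives v)
Pointwise-positives [] [] = []
Pointwise-positives {u = x ∷ u} {y ∷ v} (e ∷ es) (r ∷ rs)
  rewrite positives-∷ x u | positives-∷ y v | e with isPos y
... | true  = r ∷ Pointwise-positives es rs
... | false = Pointwise-positives es rs

Similar-positives : ∀ {u v} → Similar u v → Pointwise (λ x y → isPos x ≡ isPos y) u v →
                    Similar (positives u) (positives v)
Similar-positives [] [] = []
Similar-positives (cons {a} {b} {u} {v} sign cmp sim) (e ∷ es)
  rewrite positives-∷ a u | positives-∷ b v | e with isPos b
... | true  = cons sign (Pointwise-positives es cmp) (Similar-positives sim es)
... | false = Similar-positives sim es

st-positives-st : ∀ w → All Nonzero w → st (positives (st w)) ≡ st (positives w)
st-positives-st w w≠0 = st-resp-Similar (Similar-positives sim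
  (Similar⇒samePositivity sim (Nonzero-standardizeAt I I) w≠0))
  where
  sim = Similar-st w
  I = indexedFrom id w

-- The shapes in the definition of φ₂

-- Letters are read as `true` when negative.  From negPrefix, `run` gives weight 1 exactly to
-- the sign patterns −ⁱ+⁺ and weight −1 exactly to −ⁱ+⁺−, the two shapes in the definition of φ₂.
data Phase : Set where
  negPrefix posBlock lastNeg rejected : Phase

step : Phase → Bool → Phase
step negPrefix true  = negPrefix
step negPrefix false = posBlock
step posBlock  true  = lastNeg
step posBlock  false = posBlock
step lastNeg   _     = rejected
step rejected  _     = rejected

weight : Phase → ℤ
weight negPrefix = ℤ.0ℤ
weight posBlock  = ℤ.1ℤ
weight lastNeg   = ℤ.-1ℤ
weight rejected  = ℤ.0ℤ

run : Phase → List Bool → ℤ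
run q []      = weight q
run q (b ∷ s) = run (step q b) s

signs : Word → List Bool
signs = map isNeg

run-rejected : ∀ s → run rejected s ≡ ℤ.0ℤ
run-rejected []      = refl
run-rejected (_ ∷ s) = run-rejected s

-- The condition shapeOK imposes on the letter at (0-based) position proj₁ p: shapeOK π i j
-- unfolds to ((i + j) <ᵇ n) ∧ allB (shapeAt i (n ∸ j)) (indexed π), where n = length π.
shapeAt : ℕ → ℕ → ℕ × ℤ → Bool
shapeAt i M p = (if suc (proj₁ p) ≤ᵇ i then isNeg (proj₂ p) else true) ∧
                (if M <ᵇ suc (proj₁ p) then isNeg (proj₂ p) else true) ∧
                (if (i <ᵇ suc (proj₁ p)) ∧ (suc (proj₁ p) ≤ᵇ M) then isPos (proj₂ p) else true)

allB-shapeAt-shift : ∀ i M f π →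
  allB (shapeAt (suc i) (suc M)) (indexedFrom (suc ∘ f) π) ≡ allB (shapeAt i M) (indexedFrom f π)
allB-shapeAt-shift i M f []      = refl
allB-shapeAt-shift i M f (x ∷ π) = cong (shapeAt i M (f 0 , x) ∧_) (allB-shapeAt-shift i M (f ∘ suc) π)

∧-exchange : ∀ p q r → p ∧ ((q ∧ true) ∧ r) ≡ q ∧ (p ∧ r)
∧-exchange true  true  r = refl
∧-exchange true  false r = refl
∧-exchange false true  r = refl
∧-exchange false false r = refl

shapeOK-suc : ∀ x π i j → shapeOK (x ∷ π) (suc i) j ≡ isNeg x ∧ shapeOK π i j
shapeOK-suc x π i j with j ℕ.≤? length π
... | yes j≤n rewrite +-∸-assoc 1 j≤n | allB-shapeAt-shift i (length π ∸ j) id π =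
  ∧-exchange ((i ℕ.+ j) <ᵇ length π) (isNeg x) (allB (shapeAt i (length π ∸ j)) (indexed π))
... | no j≰n
  rewrite >⇒≤ᵇ-false {suc (i ℕ.+ j)} {length π} (s≤s (≤-trans (<⇒≤ (≰⇒> j≰n)) (m≤n+m j i))) =
  sym (∧-zeroʳ (isNeg x))

posThenNeg : ℕ → (ℕ → ℕ) → Word → Bool
posThenNeg M f π = allB (shapeAt 0 M) (indexedFrom f π)

posThenNeg-shift : ∀ M f π → posThenNeg (suc M) (suc ∘ f) π ≡ posThenNeg M f π
posThenNeg-shift M f []      = refl
posThenNeg-shift M f (x ∷ π) = cong (shapeAt 0 M (f 0 , x) ∧_) (posThenNeg-shift M (f ∘ suc) π)

posThenNeg-∷ : ∀ M x π → posThenNeg (suc M) id (x ∷ π) ≡ isPos x ∧ posThenNeg M id π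
posThenNeg-∷ M x π = cong (isPos x ∧_) (posThenNeg-shift M id π)

posThenNeg-zero : ∀ f π → posThenNeg 0 f π ≡ allB isNeg π
posThenNeg-zero f []      = refl
posThenNeg-zero f (x ∷ π) = cong₂ _∧_ (∧-identityʳ (isNeg x)) (posThenNeg-zero (f ∘ suc) π)

posThenNeg-length : ∀ π → posThenNeg (length π) id π ≡ allB isPos π
posThenNeg-length []      = refl
posThenNeg-length (x ∷ π) = trans (posThenNeg-∷ (length π) x π) (cong (isPos x ∧_) (posThenNeg-length π))

posThenOneNeg : Word → Bool
posThenOneNeg []      = false
posThenOneNeg (y ∷ ρ) = posThenNeg (length ρ) id (y ∷ ρ)

shapeOK-0-0 : ∀ x π → shapeOK (x ∷ π) 0 0 ≡ isPos x ∧ allB isPos π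
shapeOK-0-0 x π = posThenNeg-length (x ∷ π)

shapeOK-0-1 : ∀ x π → shapeOK (x ∷ π) 0 1 ≡ isPos x ∧ posThenOneNeg π
shapeOK-0-1 x []      = sym (∧-zeroʳ (isPos x))
shapeOK-0-1 x (y ∷ ρ) = posThenNeg-∷ (length ρ) x (y ∷ ρ)

run-posBlock : ∀ π → All Nonzero π →
  (if allB isPos π then ℤ.1ℤ else if posThenOneNeg π then ℤ.-1ℤ else ℤ.0ℤ) ≡ run posBlock (signs π)
run-posBlock []          _            = refl
run-posBlock (y ∷ [])    (y≠0 ∷ [])   rewrite posThenNeg-zero id (y ∷ []) | y≠0 with isNeg y
... | true  = refl
... | false = refl
run-posBlock (y ∷ z ∷ ρ) (y≠0 ∷ ρ≠0) rewrite posThenNeg-∷ (length ρ) y (z ∷ ρ) | y≠0 with isNeg y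
... | true  = sym (run-rejected (signs ρ))
... | false = run-posBlock (z ∷ ρ) ρ≠0

shapeSign : Word → List (ℕ × ℕ) → ℤ
shapeSign π []             = ℤ.0ℤ
shapeSign π ((i , j) ∷ cs) = if shapeOK π i j then (if j ≡ᵇ 0 then ℤ.1ℤ else ℤ.-1ℤ) else shapeSign π cs

candidatesAt : ℕ → List (ℕ × ℕ)
candidatesAt i = (i , 0) ∷ (i , 1) ∷ []

candidatesAt-shift : ∀ f k →
  concatMap candidatesAt (applyUpTo (suc ∘ f) k) ≡ map (map₁ suc) (concatMap candidatesAt (applyUpTo f k))
candidatesAt-shift f zero    = refl
candidatesAt-shift f (suc k) = cong ((suc (f 0) , 0) ∷_) (cong ((suc (f 0) , 1) ∷_) (candidatesAt-shift (f ∘ suc) k))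

shapeSign-shift : ∀ x π cs →
  shapeSign (x ∷ π) (map (map₁ suc) cs) ≡ (if isNeg x then shapeSign π cs else ℤ.0ℤ)
shapeSign-shift x π [] with isNeg x
... | true  = refl
... | false = refl
shapeSign-shift x π ((i , j) ∷ cs) rewrite shapeOK-suc x π i j | shapeSign-shift x π cs with isNeg x
... | true  = refl
... | false = refl

shapeSign-candidates : ∀ π → All Nonzero π → shapeSign π (candidates (length π)) ≡ run negPrefix (signs π)
shapeSign-candidates []      []          = refl
shapeSign-candidates (x ∷ π) (x≠0 ∷ π≠0) = begin
    shapeSign (x ∷ π) (candidates (length (x ∷ π)))
      ≡⟨ cong₂ (λ a b → choose a b later) (shapeOK-0-0 x π) (shapeOK-0-1 x π) ⟩
    choose (isPos x ∧ allB isPos π) (isPos x ∧ posThenOneNeg π) later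
      ≡⟨ cong (choose (isPos x ∧ allB isPos π) (isPos x ∧ posThenOneNeg π))
              (trans (cong (shapeSign (x ∷ π)) (candidatesAt-shift id (suc (length π))))
                     (shapeSign-shift x π (candidates (length π)))) ⟩
    choose (isPos x ∧ allB isPos π) (isPos x ∧ posThenOneNeg π)
           (if isNeg x then shapeSign π (candidates (length π)) else ℤ.0ℤ)
      ≡⟨ by-sign (isPos x) (isNeg x) x≠0 ⟩
    run negPrefix (signs (x ∷ π)) ∎
  where
  open ≡-Reasoning
  choose : Bool → Bool → ℤ → ℤ
  choose a b c = if a then ℤ.1ℤ else if b then ℤ.-1ℤ else c
  later : ℤ
  later = shapeSign (x ∷ π) (concatMap candidatesAt (applyUpTo suc (suc (length π))))
  by-sign : ∀ pos neg → pos ≡ not neg →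
    choose (pos ∧ allB isPos π) (pos ∧ posThenOneNeg π)
           (if neg then shapeSign π (candidates (length π)) else ℤ.0ℤ)
    ≡ run negPrefix (neg ∷ signs π)
  by-sign .false true  refl = shapeSign-candidates π π≠0
  by-sign .true  false refl = run-posBlock π π≠0

indicator : Word → Word → ℤ
indicator w v = if does (≡-dec ℤ._≟_ w v) then ℤ.1ℤ else ℤ.0ℤ

coeff-findShape : ∀ π → π ≢ [] → ∀ cs w →
  coeff w (findShape π cs) ≡ indicator w (st (positives π)) * shapeSign π cs
coeff-findShape []      π≢[] cs w = ⊥-elim (π≢[] refl)
coeff-findShape (x ∷ π) π≢[] [] w = sym (ℤ.*-zeroʳ (indicator w (st (positives (x ∷ π)))))
coeff-findShape (x ∷ π) π≢[] ((i , j) ∷ cs) w with shapeOK (x ∷ π) i j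
... | true  = single (does (≡-dec ℤ._≟_ w (st (positives (x ∷ π))))) _
  where
  single : ∀ b c → (if b then c else ℤ.0ℤ) + ℤ.0ℤ ≡ (if b then ℤ.1ℤ else ℤ.0ℤ) * c
  single true  c = trans (ℤ.+-identityʳ c) (sym (ℤ.*-identityˡ c))
  single false c = sym (ℤ.*-zeroˡ c)
... | false = coeff-findShape (x ∷ π) π≢[] cs w

signs-standardizeAt : ∀ J K → signs (standardizeAt J K) ≡ signs (map proj₂ K)
signs-standardizeAt J []            = refl
signs-standardizeAt J ((i , x) ∷ K) = cong₂ _∷_ (isNeg-withSign x (rank J (i , x))) (signs-standardizeAt J K)

coeff-φ₂-st : ∀ x → x ≢ [] → All Nonzero x → ∀ w →
  coeff w (φ₂ (st x)) ≡ indicator w (st (positives x)) * run negPrefix (signs x)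
coeff-φ₂-st []      x≢[] x≠0 w = ⊥-elim (x≢[] refl)
coeff-φ₂-st (a ∷ u) _    x≠0 w = begin
  coeff w (φ₂ (st (a ∷ u)))
    ≡⟨ coeff-findShape (st (a ∷ u)) (λ ()) (candidates (length (st (a ∷ u)))) w ⟩
  indicator w (st (positives (st (a ∷ u)))) * shapeSign (st (a ∷ u)) (candidates (length (st (a ∷ u))))
    ≡⟨ cong₂ (λ W s → indicator w W * s) (st-positives-st (a ∷ u) x≠0)
             (shapeSign-candidates (st (a ∷ u)) (Nonzero-standardizeAt I I)) ⟩
  indicator w (st (positives (a ∷ u))) * run negPrefix (signs (st (a ∷ u)))
    ≡⟨ cong (λ s → indicator w (st (positives (a ∷ u))) * run negPrefix s)
            (trans (signs-standardizeAt I I) (cong signs (map-proj₂-indexedFrom id (a ∷ u)))) ⟩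
  indicator w (st (positives (a ∷ u))) * run negPrefix (signs (a ∷ u)) ∎
  where
  open ≡-Reasoning
  I = indexedFrom id (a ∷ u)

-- Linearity

coeff-++L : ∀ w L M → coeff w (L ++L M) ≡ coeff w L + coeff w M
coeff-++L w []            M = sym (ℤ.+-identityˡ (coeff w M))
coeff-++L w ((c , v) ∷ L) M rewrite coeff-++L w L M =
  sym (ℤ.+-assoc (if does (≡-dec ℤ._≟_ w v) then c else ℤ.0ℤ) (coeff w L) (coeff w M))

coeff-scale : ∀ w c M → coeff w (map (λ p → (c * proj₁ p , proj₂ p)) M) ≡ c * coeff w M
coeff-scale w c []            = sym (ℤ.*-zeroʳ c)
coeff-scale w c ((d , v) ∷ M) rewrite coeff-scale w c M with does (≡-dec ℤ._≟_ w v)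
... | true  = sym (ℤ.*-distribˡ-+ c d (coeff w M))
... | false = trans (cong (_+ c * coeff w M) (sym (ℤ.*-zeroʳ c))) (sym (ℤ.*-distribˡ-+ c ℤ.0ℤ (coeff w M)))

weightedRun : Phase → LinComb → ℤ
weightedRun q []            = ℤ.0ℤ
weightedRun q ((c , x) ∷ L) = c * run q (signs x) + weightedRun q L

Terms : Word → LinComb → Set
Terms p = All λ t → proj₂ t ≢ [] × All Nonzero (proj₂ t) × positives (proj₂ t) ≡ p

coeff-φ₂L-stL : ∀ {p} L → Terms p L → ∀ w →
  coeff w (φ₂L (stL L)) ≡ indicator w (st p) * weightedRun negPrefix L
coeff-φ₂L-stL {p} [] [] w = sym (ℤ.*-zeroʳ (indicator w (st p)))
coeff-φ₂L-stL ((c , x) ∷ L) ((x≢[] , x≠0 , refl) ∷ terms) w = begin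
  coeff w (scaled ++L φ₂L (stL L))
    ≡⟨ coeff-++L w scaled (φ₂L (stL L)) ⟩
  coeff w scaled + coeff w (φ₂L (stL L))
    ≡⟨ cong₂ _+_ (trans (coeff-scale w c (φ₂ (st x))) (cong (c *_) (coeff-φ₂-st x x≢[] x≠0 w)))
                 (coeff-φ₂L-stL L terms w) ⟩
  c * (δ * run negPrefix (signs x)) + δ * weightedRun negPrefix L
    ≡⟨ factor c δ (run negPrefix (signs x)) (weightedRun negPrefix L) ⟩
  δ * weightedRun negPrefix ((c , x) ∷ L) ∎
  where
  open ≡-Reasoning
  scaled = map (λ p → (c * proj₁ p , proj₂ p)) (φ₂ (st x))
  δ = indicator w (st (positives x))
  factor : ∀ c δ r s → c * (δ * r) + δ * s ≡ δ * (c * r + s)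
  factor = solve-∀

φ₂L-stL-vanishes : ∀ {p L} → Terms p L → weightedRun negPrefix L ≡ ℤ.0ℤ → IsZero (φ₂L (stL L))
φ₂L-stL-vanishes {p} {L} terms sum≡0 w =
  trans (coeff-φ₂L-stL L terms w) (trans (cong (indicator w (st p) *_) sum≡0) (ℤ.*-zeroʳ (indicator w (st p))))

-- Products with a single negative letter

weightedRun-++L : ∀ q L M → weightedRun q (L ++L M) ≡ weightedRun q L + weightedRun q M
weightedRun-++L q []            M = sym (ℤ.+-identityˡ (weightedRun q M))
weightedRun-++L q ((c , x) ∷ L) M rewrite weightedRun-++L q L M =
  sym (ℤ.+-assoc (c * run q (signs x)) (weightedRun q L) (weightedRun q M))

weightedRun-prefix : ∀ q a L → weightedRun q (prefix a L) ≡ weightedRun (step q (isNeg a)) L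
weightedRun-prefix q a []            = refl
weightedRun-prefix q a ((c , x) ∷ L) = cong (_+_ (c * run (step q (isNeg a)) (signs x))) (weightedRun-prefix q a L)

weightedRun-negL : ∀ q L → weightedRun q (negL L) ≡ - weightedRun q L
weightedRun-negL q []            = refl
weightedRun-negL q ((c , x) ∷ L) rewrite weightedRun-negL q L = negate-term c (run q (signs x)) (weightedRun q L)
  where
  negate-term : ∀ c r s → - c * r + - s ≡ - (c * r + s)
  negate-term = solve-∀

weightedRun-single : ∀ q x → weightedRun q ((ℤ.1ℤ , x) ∷ []) ≡ run q (signs x)
weightedRun-single q x = trans (ℤ.+-identityʳ (ℤ.1ℤ * run q (signs x))) (ℤ.*-identityˡ (run q (signs x)))

weightedRun-merge : ∀ q a x →
  weightedRun q (negL (prefix a ((ℤ.1ℤ , x) ∷ []))) ≡ - run (step q (isNeg a)) (signs x)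
weightedRun-merge q a x = begin
  weightedRun q (negL (prefix a ((ℤ.1ℤ , x) ∷ [])))  ≡⟨ weightedRun-negL q (prefix a ((ℤ.1ℤ , x) ∷ [])) ⟩
  - weightedRun q (prefix a ((ℤ.1ℤ , x) ∷ []))      ≡⟨ cong -_ (weightedRun-prefix q a ((ℤ.1ℤ , x) ∷ [])) ⟩
  - weightedRun (step q (isNeg a)) ((ℤ.1ℤ , x) ∷ []) ≡⟨ cong -_ (weightedRun-single (step q (isNeg a)) x) ⟩
  - run (step q (isNeg a)) (signs x)                 ∎
  where open ≡-Reasoning

⋆-[] : ∀ u → u ⋆ [] ≡ (ℤ.1ℤ , u) ∷ []
⋆-[] []      = refl
⋆-[] (_ ∷ _) = refl

-- The weighted run over the terms of u ⋆ ℓ, for a single negative letter ℓ, as a function of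
-- the signs of u: ℓ is inserted in front of each suffix, and merged (with sign −1) with each
-- negative letter.
insertNeg : Phase → List Bool → ℤ
insertNeg q []      = run q (true ∷ [])
insertNeg q (b ∷ s) =
  insertNeg (step q b) s + (run q (true ∷ b ∷ s) - (if b then run (step q true) s else ℤ.0ℤ))

weightedRun-⋆-neg : ∀ k q u → weightedRun q (u ⋆ (-[1+ k ] ∷ [])) ≡ insertNeg q (signs u)
weightedRun-⋆-neg k q []      = weightedRun-single q (-[1+ k ] ∷ [])
weightedRun-⋆-neg k q (a ∷ u) = begin
  weightedRun q (prefix a (u ⋆ ℓ) ++L (prefix -[1+ k ] ((a ∷ u) ⋆ []) ++L merged a))
    ≡⟨ weightedRun-++L q (prefix a (u ⋆ ℓ)) (prefix -[1+ k ] ((a ∷ u) ⋆ []) ++L merged a) ⟩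
  weightedRun q (prefix a (u ⋆ ℓ)) + weightedRun q (prefix -[1+ k ] ((a ∷ u) ⋆ []) ++L merged a)
    ≡⟨ cong₂ _+_ (trans (weightedRun-prefix q a (u ⋆ ℓ)) (weightedRun-⋆-neg k (step q (isNeg a)) u))
                 (trans (weightedRun-++L q (prefix -[1+ k ] ((a ∷ u) ⋆ [])) (merged a))
                        (cong₂ _+_ (weightedRun-single q (-[1+ k ] ∷ a ∷ u)) (weightedRun-merged a))) ⟩
  insertNeg q (signs (a ∷ u)) ∎
  where
  open ≡-Reasoning
  ℓ = -[1+ k ] ∷ []
  merged : ℤ → LinComb
  merged a = if isNeg a ∧ true then negL (prefix a (u ⋆ [])) else []
  weightedRun-merged : ∀ a → weightedRun q (merged a) ≡ - (if isNeg a then run (step q true) (signs u) else ℤ.0ℤ)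
  weightedRun-merged (+ _)    = refl
  weightedRun-merged -[1+ n ] rewrite ⋆-[] u = weightedRun-merge q -[1+ n ] u

weightedRun-neg-⋆ : ∀ k q v → weightedRun q ((-[1+ k ] ∷ []) ⋆ v) ≡ insertNeg q (signs v)
weightedRun-neg-⋆ k q []      = weightedRun-single q (-[1+ k ] ∷ [])
weightedRun-neg-⋆ k q (c ∷ v) = begin
  weightedRun q (prefix -[1+ k ] ([] ⋆ (c ∷ v)) ++L (prefix c (ℓ ⋆ v) ++L merged c))
    ≡⟨ weightedRun-++L q (prefix -[1+ k ] ([] ⋆ (c ∷ v))) (prefix c (ℓ ⋆ v) ++L merged c) ⟩
  weightedRun q (prefix -[1+ k ] ([] ⋆ (c ∷ v))) + weightedRun q (prefix c (ℓ ⋆ v) ++L merged c)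
    ≡⟨ cong₂ _+_ (weightedRun-single q (-[1+ k ] ∷ c ∷ v))
                 (trans (weightedRun-++L q (prefix c (ℓ ⋆ v)) (merged c))
                        (cong₂ _+_ (trans (weightedRun-prefix q c (ℓ ⋆ v)) (weightedRun-neg-⋆ k (step q (isNeg c)) v))
                                   (weightedRun-merged c))) ⟩
  run q (true ∷ signs (c ∷ v)) + (insertNeg (step q (isNeg c)) (signs v) + merge-term)
    ≡⟨ x∙yz≈y∙xz (run q (true ∷ signs (c ∷ v))) (insertNeg (step q (isNeg c)) (signs v)) merge-term ⟩
  insertNeg q (signs (c ∷ v)) ∎
  where
  open ≡-Reasoning
  ℓ = -[1+ k ] ∷ []
  merged : ℤ → LinComb
  merged d = if isNeg d then negL (prefix -[1+ k ] ([] ⋆ v)) else []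
  merge-term = - (if isNeg c then run (step q true) (signs v) else ℤ.0ℤ)
  weightedRun-merged : ∀ d → weightedRun q (merged d) ≡ - (if isNeg d then run (step q true) (signs v) else ℤ.0ℤ)
  weightedRun-merged (+ _)    = refl
  weightedRun-merged -[1+ _ ] = weightedRun-merge q -[1+ k ] v

insertNeg-closedForm : Phase → List Bool → ℤ
insertNeg-closedForm posBlock s = - run posBlock s
insertNeg-closedForm _        _ = ℤ.0ℤ

insertNeg≡closedForm : ∀ q s → insertNeg q s ≡ insertNeg-closedForm q s
insertNeg≡closedForm negPrefix [] = refl
insertNeg≡closedForm posBlock  [] = refl
insertNeg≡closedForm lastNeg   [] = refl
insertNeg≡closedForm rejected  [] = refl
insertNeg≡closedForm negPrefix (false ∷ s) rewrite insertNeg≡closedForm posBlock s =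
  trans (cong (_+_ (- run posBlock s)) (ℤ.+-identityʳ (run posBlock s))) (ℤ.+-inverseˡ (run posBlock s))
insertNeg≡closedForm negPrefix (true ∷ s) rewrite insertNeg≡closedForm negPrefix s =
  trans (ℤ.+-identityˡ _) (ℤ.+-inverseʳ (run negPrefix s))
insertNeg≡closedForm posBlock (false ∷ s) rewrite insertNeg≡closedForm posBlock s | run-rejected s =
  ℤ.+-identityʳ (- run posBlock s)
insertNeg≡closedForm posBlock (true ∷ s) rewrite insertNeg≡closedForm lastNeg s | run-rejected s =
  trans (ℤ.+-identityˡ _) (ℤ.+-identityˡ (- run lastNeg s))
insertNeg≡closedForm lastNeg (false ∷ s) rewrite insertNeg≡closedForm rejected s | run-rejected s = refl
insertNeg≡closedForm lastNeg (true ∷ s) rewrite insertNeg≡closedForm rejected s | run-rejected s = refl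
insertNeg≡closedForm rejected (false ∷ s) rewrite insertNeg≡closedForm rejected s | run-rejected s = refl
insertNeg≡closedForm rejected (true ∷ s) rewrite insertNeg≡closedForm rejected s | run-rejected s = refl

insertNeg-negPrefix : ∀ s → insertNeg negPrefix s ≡ ℤ.0ℤ
insertNeg-negPrefix = insertNeg≡closedForm negPrefix

Terms-++L : ∀ {p L M} → Terms p L → Terms p M → Terms p (L ++L M)
Terms-++L []             terms-M = terms-M
Terms-++L (t ∷ terms-L) terms-M = t ∷ Terms-++L terms-L terms-M

Terms-prefix : ∀ {a p L} → Nonzero a → Terms p L → Terms (if isPos a then a ∷ p else p) (prefix a L)
Terms-prefix     a≠0 []                            = []
Terms-prefix {a} a≠0 ((_ , x≠0 , refl) ∷ terms) =
  ((λ ()) , a≠0 ∷ x≠0 , positives-∷ a _) ∷ Terms-prefix a≠0 terms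

Terms-⋆-neg : ∀ k u → All Nonzero u → Terms (positives u) (u ⋆ (-[1+ k ] ∷ []))
Terms-⋆-neg k []      []           = ((λ ()) , refl ∷ [] , refl) ∷ []
Terms-⋆-neg k (a ∷ u) (a≠0 ∷ u≠0) =
  Terms-++L (subst (λ p → Terms p (prefix a (u ⋆ (-[1+ k ] ∷ [])))) (sym (positives-∷ a u))
                   (Terms-prefix a≠0 (Terms-⋆-neg k u u≠0)))
            (((λ ()) , refl ∷ a≠0 ∷ u≠0 , refl) ∷ merged a)
  where
  merged : ∀ a → Terms (positives (a ∷ u)) (if isNeg a ∧ true then negL (prefix a (u ⋆ [])) else [])
  merged (+ _)    = []
  merged -[1+ _ ] rewrite ⋆-[] u = ((λ ()) , refl ∷ u≠0 , refl) ∷ []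

Terms-neg-⋆ : ∀ k v → All Nonzero v → Terms (positives v) ((-[1+ k ] ∷ []) ⋆ v)
Terms-neg-⋆ k []      []           = ((λ ()) , refl ∷ [] , refl) ∷ []
Terms-neg-⋆ k (c ∷ v) (c≠0 ∷ v≠0) =
  ((λ ()) , refl ∷ c≠0 ∷ v≠0 , refl)
  ∷ Terms-++L (subst (λ p → Terms p (prefix c ((-[1+ k ] ∷ []) ⋆ v))) (sym (positives-∷ c v))
                     (Terms-prefix c≠0 (Terms-neg-⋆ k v v≠0)))
              (merged c)
  where
  merged : ∀ c → Terms (positives (c ∷ v)) (if isNeg c then negL (prefix -[1+ k ] ([] ⋆ v)) else [])
  merged (+ _)    = []
  merged -[1+ _ ] = ((λ ()) , refl ∷ v≠0 , refl) ∷ []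

Nonzero-∣∣≡suc : ∀ y {m} → ∣ y ∣ ≡ suc m → Nonzero y
Nonzero-∣∣≡suc (+ suc _) _ = refl
Nonzero-∣∣≡suc -[1+ _ ]  _ = refl

IsSignedPerm⇒Nonzero : ∀ σ → IsSignedPerm σ → All Nonzero σ
IsSignedPerm⇒Nonzero σ perm = All.tabulate λ {y} y∈σ →
  let _ , _ , ∣y∣≡suc = ∈-applyUpTo⁻ suc (∈-resp-↭ perm (∈-map⁺ ∣_∣ y∈σ))
  in Nonzero-∣∣≡suc y ∣y∣≡suc

Nonzero-shift : ∀ m σ → All Nonzero (shift (suc m) σ)
Nonzero-shift m []             = []
Nonzero-shift m (+ k ∷ σ)      = Nonzero-∣∣≡suc (+ (k ℕ.+ suc m)) (+-suc k m) ∷ Nonzero-shift m σ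
Nonzero-shift m (-[1+ _ ] ∷ σ) = refl ∷ Nonzero-shift m σ

lemma4p7 : ∀ (σ : Word) → IsSignedPerm σ →
             IsZero (φ₂L (σ ⋆̄ one⁻)) × IsZero (φ₂L (one⁻ ⋆̄ σ))
lemma4p7 σ perm =
  φ₂L-stL-vanishes (Terms-⋆-neg (length σ) σ (IsSignedPerm⇒Nonzero σ perm)) right-sum ,
  φ₂L-stL-vanishes (Terms-neg-⋆ 0 (shift 1 σ) (Nonzero-shift 0 σ)) left-sum
  where
  right-sum : weightedRun negPrefix (σ ⋆ shift (length σ) one⁻) ≡ ℤ.0ℤ
  right-sum = trans (weightedRun-⋆-neg (length σ) negPrefix σ) (insertNeg-negPrefix (signs σ))
  left-sum : weightedRun negPrefix (one⁻ ⋆ shift 1 σ) ≡ ℤ.0ℤ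
  left-sum = trans (weightedRun-neg-⋆ 0 negPrefix (shift 1 σ)) (insertNeg-negPrefix (signs (shift 1 σ)))
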